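{- Let $G$ be a finite graph. If Algorithm 1 (described in the context), run on $G$ with any choices made at its choice step, returns a pair $(X,\mathcal{B})$, then $(X,\mathcal{B})$ is a good partition of $G$.
   Context: Clique paths: for a chordal graph $H$, a clique tree is a tree whose nodes are the maximal cliques of $H$ such that for every vertex $v$ the maximal cliques containing $v$ induce a subtree; a clique path $(K_1,\dots,K_k)$ is a clique tree that is a path with $K_i$ adjacent to $K_{i+1}$. If $X$ is a maximal clique of $H$, $H$ is an $X$-interval graph if $H$ admits a clique path $(K_1,\dots,K_k,X)$ ($k\ge 0$). Partitions have nonempty blocks; $\mathcal{A}\sqsubseteq\mathcal{B}$ means every block of $\mathcal{A}$ is contained in a block of $\mathcal{B}$; $\mathsf{CC}(G-X)$ is the partition of $V(G)\setminus X$ into vertex sets of connected components of $G-X$. For $X\subseteq V(G)$, $Y\subseteq X$, a partition $\mathcal{A}$ of $V(G)\setminus X$, a block $A\in\mathcal{A}$ and $x\in Y$: $N(x)$ is minimal in $A$ for $Y$ if $N(x)\cap A\subseteq N(y)$ for all $y\in Y$; $x$ is removable from $Y$ for $\mathcal{A}$ if $N(x)$ is minimal for $Y$ in at least $|\mathcal{A}|-1$ blocks. $\mathsf{notmin}(x,Y,\mathcal{A})$ is the union of the blocks of $\mathcal{A}$ in which $N(x)$ is not minimal for $Y$. A good partition of $G$ is a pair $(X,\mathcal{B})$ with $X$ a maximal clique of $G$ and $\mathcal{B}$ a partition of $V(G)\setminus X$ such that (i) $\mathsf{CC}(G-X)\sqsubseteq\mathcal{B}$; (ii) $G[X\cup B]$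 is an $X$-interval graph for every $B\in\mathcal{B}$; (iii) there is an ordering $(x_1,\dots,x_t)$ of $X$ with $x_i$ removable from $\{x_i,\dots,x_t\}$ for $\mathcal{B}$ for every $i\in[t]$. Algorithm 1 (input: graph $G$; output: a pair or "no"): If $G$ is not chordal, return "no". Otherwise, for each maximal clique $X$ of $G$ in turn: if some connected component $C$ of $G-X$ has $G[X\cup V(C)]$ not an $X$-interval graph, proceed to the next $X$. Otherwise set $\mathcal{A}\leftarrow\mathsf{CC}(G-X)$, $W\leftarrow X$, $r\leftarrow 1$, and while $W\neq\emptyset$: if there is $w\in W$ such that $G[X\cup\mathsf{notmin}(w,W,\mathcal{A})]$ is an $X$-interval graph, choose one such $w$ (arbitrarily) and set $w_r\leftarrow w$; otherwise exit the while loop. Then replace in $\mathcal{A}$ the blocks contained in $\mathsf{notmin}(w_r,W,\mathcal{A})$ by their union, set $W\leftarrow W\setminus\{w_r\}$, $r\leftarrow r+1$. After the loop, if $W=\emptyset$ return $(X,\mathcal{A})$; otherwise proceed to the next $X$. If no maximal clique led to a return, return "no". -}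

module Defs where

open import Data.Bool using (Bool; true; false; if_then_else_)
open import Data.Nat as ℕ using (ℕ; suc; _∸_; _≤_)
open import Data.Fin as F using (Fin; toℕ)
open import Data.Fin.Subset using (Subset; _∈_; _∉_; _⊆_; _∩_; _∪_; ∁; ⊥; ⊤; ⁅_⁆; _-_; Nonempty; Empty)
open import Data.Fin.Subset.Properties using (_∈?_; _⊆?_)
open import Data.Fin.Properties using (all?)
open import Data.Vec using (tabulate)
open import Data.List as L using (List; []; _∷_; _++_; [_]; length; filter; foldr; null; lookup)
open import Data.List.Relation.Unary.All using (All)
open import Data.List.Relation.Unary.Any using (Any)
open import Data.List.Relation.Unary.AllPairs using (AllPairs)
open import Data.List.Relation.Unary.Unique.Propositional using (Unique)
open import Data.List.Membership.Propositional using () renaming (_∈_ to _∈L_)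
open import Data.Product using (Σ; ∃; ∃-syntax; _×_; _,_)
open import Data.Sum using (_⊎_)
open import Data.Unit using (⊤) renaming (tt to tt)
open import Function.Definitions using (Injective)
open import Function.Bundles using (_⇔_)
open import Relation.Binary.PropositionalEquality using (_≡_; _≢_)
open import Relation.Binary.Construct.Closure.ReflexiveTransitive using (Star)
open import Relation.Nullary using (¬_; Dec; ¬?)
open import Relation.Nullary.Decidable using (_→-dec_)

record Graph : Set where
  field
    n     : ℕ
    E     : Fin n → Fin n → Bool
    sym   : ∀ u v → E u v ≡ E v u
    irrefl : ∀ v → E v v ≡ false

open Graph public

Vtx : Graph → Set
Vtx G = Fin (n G)

VSet : Graph → Set
VSet G = Subset (n G)

module _ (G : Graph) where

  Adj : Vtx G → Vtx G → Set
  Adj u v = E G u v ≡ true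

  N : Vtx G → VSet G
  N x = tabulate (E G x)

  -- Chordality: every cycle of length ≥ 4 has a chord.
  -- A cycle of length k+1 is an injective f : Fin (suc k) → V with
  -- f i adjacent to f j whenever j is the cyclic successor of i.

  CycSucc : (k : ℕ) → Fin (suc k) → Fin (suc k) → Set
  CycSucc k i j = (toℕ j ≡ suc (toℕ i)) ⊎ ((toℕ i ≡ k) × (toℕ j ≡ 0))

  Chordal : Set
  Chordal = ∀ (k : ℕ) → 3 ≤ k → (f : Fin (suc k) → Vtx G) →
            Injective _≡_ _≡_ f →
            (∀ i j → CycSucc k i j → Adj (f i) (f j)) →
            ∃[ i ] ∃[ j ] (i ≢ j × ¬ CycSucc k i j × ¬ CycSucc k j i × Adj (f i) (f j))

  Clique : VSet G → Set
  Clique C = ∀ u v → u ∈ C → v ∈ C → u ≢ v → Adj u v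

  MaxCliqueIn : VSet G → VSet G → Set
  MaxCliqueIn S C = C ⊆ S × Clique C × (∀ D → D ⊆ S → Clique D → C ⊆ D → D ⊆ C)

  MaxClique : VSet G → Set
  MaxClique C = MaxCliqueIn Data.Fin.Subset.⊤ C

  CliquePath : VSet G → List (VSet G) → Set
  CliquePath S Ks =
    All (MaxCliqueIn S) Ks × Unique Ks × (∀ C → MaxCliqueIn S C → C ∈L Ks) ×
    (∀ v (i j l : Fin (length Ks)) → i F.< j → j F.< l →
       v ∈ lookup Ks i → v ∈ lookup Ks l → v ∈ lookup Ks j)

  -- G[S] is an X-interval graph: X is a maximal clique of G[S] and G[S]
  -- admits a clique path (K₁,…,K_k,X), k ≥ 0.
  XInterval : VSet G → VSet G → Set
  XInterval S X = ∃[ Ks ] CliquePath S (Ks ++ [ X ])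

  IsPartitionOf : List (VSet G) → VSet G → Set
  IsPartitionOf P U =
    All Nonempty P × AllPairs (λ A B → Empty (A ∩ B)) P ×
    (∀ v → v ∈ U ⇔ Any (v ∈_) P)

  _⊑_ : List (VSet G) → List (VSet G) → Set
  𝒜 ⊑ ℬ = All (λ A → Any (λ B → A ⊆ B) ℬ) 𝒜

  data Reach (S : VSet G) : Vtx G → Vtx G → Set where
    here : ∀ {u} → u ∈ S → Reach S u u
    step : ∀ {u v w} → u ∈ S → Adj u v → Reach S v w → Reach S u w

  IsCC : VSet G → List (VSet G) → Set
  IsCC X P = IsPartitionOf P (∁ X) ×
    All (λ C → (∀ u v → u ∈ C → v ∈ C → Reach (∁ X) u v) ×
               (∀ u v → u ∈ C → Reach (∁ X) u v → v ∈ C)) P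

  Minimal : Vtx G → VSet G → VSet G → Set
  Minimal x Y A = ∀ y → y ∈ Y → (N x ∩ A) ⊆ N y

  minimal? : ∀ x Y A → Dec (Minimal x Y A)
  minimal? x Y A = all? (λ y → (y ∈? Y) →-dec ((N x ∩ A) ⊆? N y))

  ⋃ : List (VSet G) → VSet G
  ⋃ = foldr _∪_ ⊥

  Removable : Vtx G → VSet G → List (VSet G) → Set
  Removable x Y 𝒜 = length 𝒜 ∸ 1 ≤ length (filter (minimal? x Y) 𝒜)

  notmin : Vtx G → VSet G → List (VSet G) → VSet G
  notmin x Y 𝒜 = ⋃ (filter (λ A → ¬? (minimal? x Y A)) 𝒜)

  toSet : List (Vtx G) → VSet G
  toSet = foldr (λ x s → ⁅ x ⁆ ∪ s) ⊥

  RemovableSeq : List (VSet G) → List (Vtx G) → Set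
  RemovableSeq ℬ [] = Data.Unit.⊤
  RemovableSeq ℬ (x ∷ xs) = Removable x (toSet (x ∷ xs)) ℬ × RemovableSeq ℬ xs

  GoodPartition : VSet G → List (VSet G) → Set
  GoodPartition X ℬ =
    MaxClique X × IsPartitionOf ℬ (∁ X) ×
    (∀ P → IsCC X P → P ⊑ ℬ) ×
    All (λ B → XInterval (X ∪ B) X) ℬ ×
    (∃[ xs ] (Unique xs × (∀ v → v ∈ X ⇔ v ∈L xs) × RemovableSeq ℬ xs))

  merge : VSet G → List (VSet G) → List (VSet G)
  merge M 𝒜 =
    let inside  = filter (λ A → A ⊆? M) 𝒜
        outside = filter (λ A → ¬? (A ⊆? M)) 𝒜
    in if null inside then 𝒜 else (⋃ inside ∷ outside)

  data LoopStep (X : VSet G) : (List (VSet G) × VSet G) → (List (VSet G) × VSet G) → Set where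
    pick : ∀ 𝒜 W w → w ∈ W → XInterval (X ∪ notmin w W 𝒜) X →
           LoopStep X (𝒜 , W) (merge (notmin w W 𝒜) 𝒜 , W - w)

  Algorithm1Returns : VSet G → List (VSet G) → Set
  Algorithm1Returns X ℬ =
    Chordal × MaxClique X ×
    (∃[ P ] (IsCC X P × All (λ C → XInterval (X ∪ C) X) P ×
             Star (LoopStep X) (P , X) (ℬ , ⊥)))

{-# OPTIONS --safe #-}
module Submission where

-- Every iteration of the loop merges blocks, so the current partition of
-- V ∖ X stays a coarsening of CC(G - X), and every block stays X-interval
-- because the merged block is exactly notmin(w, W, 𝒜), which the algorithm
-- tested. For removability, the order is the order in which the vertices are
-- picked, so W at the moment w is picked is {w, …, w_t}. Right after that
-- step all blocks in which N(w) is not minimal for W lie inside the merged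
-- block, so there is at most one of them; later merges cannot create a
-- second one, since a union of blocks in which N(w) is minimal is again one
-- in which it is minimal. Hence N(w) is minimal in all but at most one block
-- of the final partition.

open import Defs
open import Data.Fin.Subset using (Subset)
open import Data.List using (List)

open import Data.Nat using (zero; suc; _∸_; _≤_; z≤n; s≤s)
open import Data.Nat.Properties using (≤-reflexive)
open import Data.Fin as Fin using (Fin; _≟_)
import Data.Vec.Base as Vec
open import Data.Fin.Subset using (_∈_; _∉_; _⊆_; _∩_; _∪_; ∁; ⁅_⁆; _-_; Nonempty; Empty)
  renaming (⊥ to ∅)
open import Data.Fin.Subset.Properties
  using (_⊆?_; x∈p∪q⁺; x∈p∪q⁻; x∈p∩q⁺; x∈p∩q⁻; ∉⊥; ⊆-refl; ⊆-trans; ⊆-antisym;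
         x∈⁅x⁆; x∈⁅y⁆⇒x≡y; x∈p∧x≢y⇒x∈p-y; p─q⊆p)
open import Data.List using ([]; _∷_; filter; length)
open import Data.List.Properties using (filter-all)
open import Data.List.Relation.Unary.All as All using (All; []; _∷_)
import Data.List.Relation.Unary.All.Properties as All
open import Data.List.Relation.Unary.Any as Any using (Any; here; there)
import Data.List.Relation.Unary.Any.Properties as Any
open import Data.List.Relation.Unary.AllPairs using (AllPairs; []; _∷_)
import Data.List.Relation.Unary.AllPairs.Properties as AllPairs
open import Data.List.Relation.Unary.Unique.Propositional using (Unique)
open import Data.List.Membership.Propositional using (find; lose) renaming (_∈_ to _∈L_)
open import Data.List.Membership.Propositional.Properties using (∈-filter⁺; ∈-filter⁻)
open import Data.Product using (_×_; _,_; proj₁; proj₂)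
open import Data.Sum using (_⊎_; inj₁; inj₂; [_,_]′)
open import Data.Empty using (⊥; ⊥-elim)
open import Function using (_∘_; case_of_)
open import Level using (_⊔_)
open import Function.Bundles using (_⇔_; mk⇔; Equivalence)
import Function.Properties.Equivalence as ⇔
open import Relation.Binary.PropositionalEquality as ≡ using (_≡_; _≢_; refl; subst)
open import Relation.Binary.Construct.Closure.ReflexiveTransitive using (Star; ε; _◅_; fold)
open import Data.Unit using (tt)
open import Relation.Nullary using (¬_; yes; no; ¬?)
open import Relation.Nullary.Decidable using (decidable-stable)
open import Relation.Unary using (Decidable)

AtMostOne : ∀ {a p} {A : Set a} → (A → Set p) → List A → Set (a ⊔ p)
AtMostOne P xs = ∀ {x y} → x ∈L xs → y ∈L xs → P x → P y → x ≡ y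

length∸1≤length-filter : ∀ {a p} {A : Set a} {P : A → Set p} (P? : Decidable P) {xs : List A} →
  Unique xs → AtMostOne (¬_ ∘ P) xs → length xs ∸ 1 ≤ length (filter P? xs)
length∸1≤length-filter P? {[]} _ _ = z≤n
length∸1≤length-filter {P = P} P? {x ∷ xs} (x∉xs ∷ unique) atMostOne with P? x
... | yes px =
  ≤-suc-pred (length xs) (length∸1≤length-filter P? unique (λ y∈ z∈ → atMostOne (there y∈) (there z∈)))
  where
  ≤-suc-pred : ∀ m {n} → m ∸ 1 ≤ n → m ≤ suc n
  ≤-suc-pred zero    _   = z≤n
  ≤-suc-pred (suc m) m≤n = s≤s m≤n
... | no ¬px =
  ≤-reflexive (≡.cong length (≡.sym (filter-all P? (All.tabulate all-P))))
  where
  all-P : ∀ {y} → y ∈L xs → P y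
  all-P {y} y∈ = decidable-stable (P? y) λ ¬py →
    All.lookup x∉xs y∈ (atMostOne (here refl) (there y∈) ¬px ¬py)

x∉p-x : ∀ {n} (x : Fin n) (p : Subset n) → x ∉ p - x
x∉p-x Fin.zero    (_ Vec.∷ p) ()
x∉p-x (Fin.suc x) (_ Vec.∷ p) (Vec.there x∈) = x∉p-x x p x∈

x∈p⇒p≡⁅x⁆∪p-x : ∀ {n} {x : Fin n} {p : Subset n} → x ∈ p → p ≡ ⁅ x ⁆ ∪ (p - x)
x∈p⇒p≡⁅x⁆∪p-x {x = x} {p} x∈p = ⊆-antisym split join
  where
  split : p ⊆ ⁅ x ⁆ ∪ (p - x)
  split {v} v∈p with v ≟ x
  ... | yes refl = x∈p∪q⁺ (inj₁ (x∈⁅x⁆ x))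
  ... | no  v≢x  = x∈p∪q⁺ (inj₂ (x∈p∧x≢y⇒x∈p-y v∈p v≢x))
  join : ⁅ x ⁆ ∪ (p - x) ⊆ p
  join {v} v∈ = [ (λ v∈⁅x⁆ → subst (_∈ p) (≡.sym (x∈⁅y⁆⇒x≡y x v∈⁅x⁆)) x∈p) , p─q⊆p p ⁅ x ⁆ ]′
                 (x∈p∪q⁻ ⁅ x ⁆ (p - x) v∈)

Star-preserves : ∀ {i t q} {I : Set i} {T : I → I → Set t} (Q : I → Set q) →
  (∀ {s u} → T s u → Q s → Q u) → ∀ {s u} → Star T s u → Q s → Q u
Star-preserves Q preserves = fold (λ s u → Q s → Q u) (λ step k → k ∘ preserves step) (λ q → q)

module _ (G : Graph) where

  Blocks : Set
  Blocks = List (VSet G)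

  Disjoint : VSet G → VSet G → Set
  Disjoint A B = Empty (A ∩ B)

  ∈-⋃⁺ : ∀ {v} (𝒜 : Blocks) → Any (v ∈_) 𝒜 → v ∈ ⋃ G 𝒜
  ∈-⋃⁺ (A ∷ 𝒜) (here v∈A)  = x∈p∪q⁺ (inj₁ v∈A)
  ∈-⋃⁺ (A ∷ 𝒜) (there v∈𝒜) = x∈p∪q⁺ (inj₂ (∈-⋃⁺ 𝒜 v∈𝒜))

  ∈-⋃⁻ : ∀ {v} (𝒜 : Blocks) → v ∈ ⋃ G 𝒜 → Any (v ∈_) 𝒜
  ∈-⋃⁻ []      v∈ = ⊥-elim (∉⊥ v∈)
  ∈-⋃⁻ (A ∷ 𝒜) v∈ = [ here , there ∘ ∈-⋃⁻ 𝒜 ]′ (x∈p∪q⁻ A (⋃ G 𝒜) v∈)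

  ∈-toSet⇔ : ∀ {v} (xs : List (Vtx G)) → v ∈ toSet G xs ⇔ v ∈L xs
  ∈-toSet⇔ xs = mk⇔ (to xs) from
    where
    to : ∀ {v} (xs : List (Vtx G)) → v ∈ toSet G xs → v ∈L xs
    to []       v∈ = ⊥-elim (∉⊥ v∈)
    to (x ∷ xs) v∈ = [ here ∘ x∈⁅y⁆⇒x≡y x , there ∘ to xs ]′ (x∈p∪q⁻ ⁅ x ⁆ (toSet G xs) v∈)
    from : ∀ {v} {xs : List (Vtx G)} → v ∈L xs → v ∈ toSet G xs
    from (here refl) = x∈p∪q⁺ (inj₁ (x∈⁅x⁆ _))
    from (there v∈)  = x∈p∪q⁺ (inj₂ (from v∈))

  disjoint-blocks-equal : ∀ {𝒜 : Blocks} {A B v} → AllPairs Disjoint 𝒜 →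
    A ∈L 𝒜 → B ∈L 𝒜 → v ∈ A → v ∈ B → A ≡ B
  disjoint-blocks-equal (_ ∷ _)   (here refl) (here refl) _   _   = refl
  disjoint-blocks-equal (A#𝒜 ∷ _) (here refl) (there B∈)  v∈A v∈B = ⊥-elim (All.lookup A#𝒜 B∈ (_ , x∈p∩q⁺ (v∈A , v∈B)))
  disjoint-blocks-equal (B#𝒜 ∷ _) (there A∈)  (here refl) v∈A v∈B = ⊥-elim (All.lookup B#𝒜 A∈ (_ , x∈p∩q⁺ (v∈B , v∈A)))
  disjoint-blocks-equal (_ ∷ 𝒜#)  (there A∈)  (there B∈)  v∈A v∈B = disjoint-blocks-equal 𝒜# A∈ B∈ v∈A v∈B

  partition-unique : ∀ {𝒜 : Blocks} → All Nonempty 𝒜 → AllPairs Disjoint 𝒜 → Unique 𝒜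
  partition-unique []                 []          = []
  partition-unique ((v , v∈A) ∷ nonempty) (A#𝒜 ∷ 𝒜#) =
    All.map (λ { A#A refl → A#A (v , x∈p∩q⁺ (v∈A , v∈A)) }) A#𝒜 ∷ partition-unique nonempty 𝒜#

  inside outside : VSet G → Blocks → Blocks
  inside  M = filter (_⊆? M)
  outside M = filter (¬? ∘ (_⊆? M))

  inside-or-outside : ∀ {A M} {𝒜 : Blocks} → A ∈L 𝒜 → A ∈L inside M 𝒜 ⊎ A ∈L outside M 𝒜
  inside-or-outside {A} {M} A∈ with A ⊆? M
  ... | yes A⊆M = inj₁ (∈-filter⁺ (_⊆? M) A∈ A⊆M)
  ... | no  A⊈M = inj₂ (∈-filter⁺ (¬? ∘ (_⊆? M)) A∈ A⊈M)

  ∈-inside⁻ : ∀ {A M} (𝒜 : Blocks) → A ∈L inside M 𝒜 → A ∈L 𝒜 × A ⊆ M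
  ∈-inside⁻ {M = M} 𝒜 = ∈-filter⁻ (_⊆? M) {xs = 𝒜}

  ∈-outside⁻ : ∀ {A M} (𝒜 : Blocks) → A ∈L outside M 𝒜 → A ∈L 𝒜 × ¬ A ⊆ M
  ∈-outside⁻ {M = M} 𝒜 = ∈-filter⁻ (¬? ∘ (_⊆? M)) {xs = 𝒜}

  data MergeView (M : VSet G) (𝒜 : Blocks) : Blocks → Set where
    unchanged : (∀ {A} → A ∈L 𝒜 → ¬ A ⊆ M) → MergeView M 𝒜 𝒜
    merged    : ∀ {A} → A ∈L inside M 𝒜 → MergeView M 𝒜 (⋃ G (inside M 𝒜) ∷ outside M 𝒜)

  mergeView : ∀ M 𝒜 → MergeView M 𝒜 (merge G M 𝒜)
  mergeView M 𝒜 with inside M 𝒜 in eq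
  ... | []    = unchanged λ A∈ A⊆M → case subst (_ ∈L_) eq (∈-filter⁺ (_⊆? M) A∈ A⊆M) of λ ()
  ... | A ∷ _ = subst (λ ins → MergeView M 𝒜 (⋃ G ins ∷ outside M 𝒜)) eq
                  (merged (subst (A ∈L_) (≡.sym eq) (here refl)))

  ⊑-refl : (𝒜 : Blocks) → _⊑_ G 𝒜 𝒜
  ⊑-refl 𝒜 = All.tabulate λ A∈ → lose A∈ ⊆-refl

  ⊑-trans : {𝒜 ℬ 𝒞 : Blocks} → _⊑_ G 𝒜 ℬ → _⊑_ G ℬ 𝒞 → _⊑_ G 𝒜 𝒞
  ⊑-trans {ℬ = ℬ} {𝒞} 𝒜⊑ℬ ℬ⊑𝒞 = All.map coarsen 𝒜⊑ℬ
    where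
    coarsen : ∀ {A} → Any (A ⊆_) ℬ → Any (A ⊆_) 𝒞
    coarsen A⊆ℬ with find A⊆ℬ
    ... | B , B∈ , A⊆B = Any.map (⊆-trans A⊆B) (All.lookup ℬ⊑𝒞 B∈)

  CC-⊑ : ∀ {X P′ P} → IsCC G X P′ → IsCC G X P → _⊑_ G P′ P
  CC-⊑ {P′ = P′} {P} ((nonempty′ , _ , covers′) , connected′) ((_ , _ , covers) , closed) =
    All.tabulate component⊆
    where
    component⊆ : ∀ {A} → A ∈L P′ → Any (A ⊆_) P
    component⊆ A∈ with All.lookup nonempty′ A∈
    ... | a , a∈A with find (Equivalence.to (covers a) (Equivalence.from (covers′ a) (lose A∈ a∈A)))
    ... | C , C∈ , a∈C = lose C∈ λ {u} u∈A →
      proj₂ (All.lookup closed C∈) a u a∈C (proj₁ (All.lookup connected′ A∈) a u a∈A u∈A)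

  merge-refines : ∀ M 𝒜 → _⊑_ G 𝒜 (merge G M 𝒜)
  merge-refines M 𝒜 with merge G M 𝒜 | mergeView M 𝒜
  ... | _ | unchanged _ = ⊑-refl 𝒜
  ... | _ | merged _    = All.tabulate λ A∈ →
    [ (λ A∈in → here (λ {_} v∈A → ∈-⋃⁺ _ (lose A∈in v∈A)))
    , (λ A∈out → there (lose A∈out (λ {_} → ⊆-refl)))
    ]′
    (inside-or-outside A∈)

  Any-∈-merge : ∀ {v} M 𝒜 → Any (v ∈_) 𝒜 ⇔ Any (v ∈_) (merge G M 𝒜)
  Any-∈-merge {v} M 𝒜 with merge G M 𝒜 | mergeView M 𝒜
  ... | _ | unchanged _ = ⇔.refl
  ... | _ | merged _    = mk⇔ to from
    where
    to : Any (v ∈_) 𝒜 → Any (v ∈_) (⋃ G (inside M 𝒜) ∷ outside M 𝒜)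
    to v∈𝒜 with find v∈𝒜
    ... | A , A∈ , v∈A =
      [ (λ A∈in → here (∈-⋃⁺ _ (lose A∈in v∈A))) , (λ A∈out → there (lose A∈out v∈A)) ]′
      (inside-or-outside A∈)
    from : Any (v ∈_) (⋃ G (inside M 𝒜) ∷ outside M 𝒜) → Any (v ∈_) 𝒜
    from (here v∈⋃)    = Any.filter⁻ (_⊆? M) (∈-⋃⁻ _ v∈⋃)
    from (there v∈out) = Any.filter⁻ (¬? ∘ (_⊆? M)) v∈out

  merge-nonempty-disjoint : ∀ M 𝒜 → All Nonempty 𝒜 → AllPairs Disjoint 𝒜 →
    All Nonempty (merge G M 𝒜) × AllPairs Disjoint (merge G M 𝒜)
  merge-nonempty-disjoint M 𝒜 nonempty disjoint with merge G M 𝒜 | mergeView M 𝒜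
  ... | _ | unchanged _ = nonempty , disjoint
  ... | _ | merged A∈in =
    (⋃-nonempty ∷ All.filter⁺ (¬? ∘ (_⊆? M)) nonempty) ,
    (⋃-disjoint ∷ AllPairs.filter⁺ (¬? ∘ (_⊆? M)) disjoint)
    where
    ⋃-nonempty : Nonempty (⋃ G (inside M 𝒜))
    ⋃-nonempty with All.lookup nonempty (proj₁ (∈-inside⁻ 𝒜 A∈in))
    ... | v , v∈A = v , ∈-⋃⁺ _ (lose A∈in v∈A)
    ⋃-disjoint : All (Disjoint (⋃ G (inside M 𝒜))) (outside M 𝒜)
    ⋃-disjoint = All.tabulate λ {B} B∈out (v , v∈) →
      let v∈⋃ , v∈B     = x∈p∩q⁻ _ B v∈
          C , C∈in , v∈C = find (∈-⋃⁻ _ v∈⋃)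
          C∈ , C⊆M      = ∈-inside⁻ 𝒜 C∈in
          B∈ , B⊈M      = ∈-outside⁻ 𝒜 B∈out
      in B⊈M (subst (_⊆ M) (disjoint-blocks-equal disjoint C∈ B∈ v∈C v∈B) C⊆M)

  merge-isPartition : ∀ {U} M 𝒜 → IsPartitionOf G 𝒜 U → IsPartitionOf G (merge G M 𝒜) U
  merge-isPartition M 𝒜 (nonempty , disjoint , covers) =
    let nonempty′ , disjoint′ = merge-nonempty-disjoint M 𝒜 nonempty disjoint
    in nonempty′ , disjoint′ , λ v → ⇔.trans (covers v) (Any-∈-merge M 𝒜)

  ⋃-inside-⋃ : (ℒ 𝒜 : Blocks) → (∀ {A} → A ∈L ℒ → A ∈L 𝒜) → ⋃ G (inside (⋃ G ℒ) 𝒜) ≡ ⋃ G ℒ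
  ⋃-inside-⋃ ℒ 𝒜 ℒ⊆𝒜 = ⊆-antisym ⋃inside⊆ ⊆⋃inside
    where
    ⋃inside⊆ : ⋃ G (inside (⋃ G ℒ) 𝒜) ⊆ ⋃ G ℒ
    ⋃inside⊆ v∈ with find (∈-⋃⁻ _ v∈)
    ... | A , A∈in , v∈A = proj₂ (∈-inside⁻ 𝒜 A∈in) v∈A
    ⊆⋃inside : ⋃ G ℒ ⊆ ⋃ G (inside (⋃ G ℒ) 𝒜)
    ⊆⋃inside v∈ with find (∈-⋃⁻ ℒ v∈)
    ... | A , A∈ℒ , v∈A =
      ∈-⋃⁺ _ (lose (∈-filter⁺ (_⊆? ⋃ G ℒ) (ℒ⊆𝒜 A∈ℒ) λ {_} u∈A → ∈-⋃⁺ ℒ (lose A∈ℒ u∈A)) v∈A)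

  merge-All : ∀ {q} {Q : VSet G → Set q} (ℒ 𝒜 : Blocks) → (∀ {A} → A ∈L ℒ → A ∈L 𝒜) →
    Q (⋃ G ℒ) → All Q 𝒜 → All Q (merge G (⋃ G ℒ) 𝒜)
  merge-All {Q = Q} ℒ 𝒜 ℒ⊆𝒜 Q⋃ Q𝒜 with merge G (⋃ G ℒ) 𝒜 | mergeView (⋃ G ℒ) 𝒜
  ... | _ | unchanged _ = Q𝒜
  ... | _ | merged _    =
    subst Q (≡.sym (⋃-inside-⋃ ℒ 𝒜 ℒ⊆𝒜)) Q⋃ ∷ All.filter⁺ (¬? ∘ (_⊆? ⋃ G ℒ)) Q𝒜

  merge-atMostOne : ∀ {q} {Q : VSet G → Set q} M 𝒜 → (∀ ℒ → Q (⋃ G ℒ) → Any Q ℒ) →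
    AtMostOne Q 𝒜 → AtMostOne Q (merge G M 𝒜)
  merge-atMostOne {Q = Q} M 𝒜 Q-⋃ atMostOne with merge G M 𝒜 | mergeView M 𝒜
  ... | _ | unchanged _ = atMostOne
  ... | _ | merged _    = onMerged
    where
    no-second : ∀ {B} → Q (⋃ G (inside M 𝒜)) → B ∈L outside M 𝒜 → Q B → ⊥
    no-second Q⋃ B∈out QB with find (Q-⋃ _ Q⋃)
    ... | C , C∈in , QC =
      let C∈ , C⊆M = ∈-inside⁻ 𝒜 C∈in
          B∈ , B⊈M = ∈-outside⁻ 𝒜 B∈out
      in B⊈M (subst (_⊆ M) (atMostOne C∈ B∈ QC QB) C⊆M)
    onMerged : AtMostOne Q (⋃ G (inside M 𝒜) ∷ outside M 𝒜)
    onMerged (here refl) (here refl) _  _  = refl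
    onMerged (here refl) (there B∈)  QA QB = ⊥-elim (no-second QA B∈ QB)
    onMerged (there A∈)  (here refl) QA QB = ⊥-elim (no-second QB A∈ QA)
    onMerged (there A∈)  (there B∈)  QA QB =
      atMostOne (proj₁ (∈-outside⁻ 𝒜 A∈)) (proj₁ (∈-outside⁻ 𝒜 B∈)) QA QB

  merge-covering-atMostOne : ∀ {q} {Q : VSet G → Set q} M 𝒜 →
    (∀ {A} → A ∈L 𝒜 → Q A → A ⊆ M) → AtMostOne Q (merge G M 𝒜)
  merge-covering-atMostOne {Q = Q} M 𝒜 Q⊆M with merge G M 𝒜 | mergeView M 𝒜
  ... | _ | unchanged none⊆M = λ A∈ _ QA _ → ⊥-elim (none⊆M A∈ (Q⊆M A∈ QA))
  ... | _ | merged _         = onMerged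
    where
    outside-not-Q : ∀ {B} → B ∈L outside M 𝒜 → Q B → ⊥
    outside-not-Q B∈out QB = let B∈ , B⊈M = ∈-outside⁻ 𝒜 B∈out in B⊈M (Q⊆M B∈ QB)
    onMerged : AtMostOne Q (⋃ G (inside M 𝒜) ∷ outside M 𝒜)
    onMerged (here refl) (here refl) _ _  = refl
    onMerged (here refl) (there B∈)  _ QB = ⊥-elim (outside-not-Q B∈ QB)
    onMerged (there A∈)  _           QA _ = ⊥-elim (outside-not-Q A∈ QA)

  minimal-⋃ : ∀ {w Y} (ℒ : Blocks) → All (Minimal G w Y) ℒ → Minimal G w Y (⋃ G ℒ)
  minimal-⋃ {w} ℒ minimal y y∈Y v∈ with x∈p∩q⁻ (N G w) (⋃ G ℒ) v∈
  ... | v∈Nw , v∈⋃ with find (∈-⋃⁻ ℒ v∈⋃)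
  ... | A , A∈ , v∈A = All.lookup minimal A∈ y y∈Y (x∈p∩q⁺ (v∈Nw , v∈A))

  notMinimal-⋃ : ∀ {w Y} (ℒ : Blocks) → ¬ Minimal G w Y (⋃ G ℒ) → Any (¬_ ∘ Minimal G w Y) ℒ
  notMinimal-⋃ {w} {Y} ℒ ¬minimal = All.¬All⇒Any¬ (minimal? G w Y) ℒ (¬minimal ∘ minimal-⋃ ℒ)

  notMinimal⊆notmin : ∀ {w Y A} (𝒜 : Blocks) → A ∈L 𝒜 → ¬ Minimal G w Y A → A ⊆ notmin G w Y 𝒜
  notMinimal⊆notmin {w} {Y} 𝒜 A∈ ¬minimal v∈A =
    ∈-⋃⁺ _ (lose (∈-filter⁺ (λ A → ¬? (minimal? G w Y A)) A∈ ¬minimal) v∈A)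

  atMostOne-removable : ∀ {w Y U ℬ} → IsPartitionOf G ℬ U →
    AtMostOne (¬_ ∘ Minimal G w Y) ℬ → Removable G w Y ℬ
  atMostOne-removable {w} {Y} (nonempty , disjoint , _) =
    length∸1≤length-filter (minimal? G w Y) (partition-unique nonempty disjoint)

  module _ {X : VSet G} where

    Run : Blocks × VSet G → Blocks × VSet G → Set
    Run = Star (LoopStep G X)

    run-isPartition : ∀ {s t} → Run s t →
      IsPartitionOf G (proj₁ s) (∁ X) → IsPartitionOf G (proj₁ t) (∁ X)
    run-isPartition = Star-preserves (λ s → IsPartitionOf G (proj₁ s) (∁ X))
      λ { (pick 𝒜 W w _ _) → merge-isPartition (notmin G w W 𝒜) 𝒜 }

    run-XInterval : ∀ {s t} → Run s t →
      All (λ B → XInterval G (X ∪ B) X) (proj₁ s) → All (λ B → XInterval G (X ∪ B) X) (proj₁ t)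
    run-XInterval = Star-preserves (λ s → All (λ B → XInterval G (X ∪ B) X) (proj₁ s))
      λ { (pick 𝒜 W w _ notmin-XInterval) →
            merge-All (filter (λ A → ¬? (minimal? G w W A)) 𝒜) 𝒜
              (proj₁ ∘ ∈-filter⁻ (λ A → ¬? (minimal? G w W A)) {xs = 𝒜}) notmin-XInterval }

    run-refines : ∀ {s t} → Run s t → _⊑_ G (proj₁ s) (proj₁ t)
    run-refines = fold (λ s t → _⊑_ G (proj₁ s) (proj₁ t))
      (λ { (pick 𝒜 W w _ _) → ⊑-trans (merge-refines (notmin G w W 𝒜) 𝒜) }) (⊑-refl _)

    run-atMostOne : ∀ {w Y s t} → Run s t →
      AtMostOne (¬_ ∘ Minimal G w Y) (proj₁ s) → AtMostOne (¬_ ∘ Minimal G w Y) (proj₁ t)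
    run-atMostOne = Star-preserves _
      λ { (pick 𝒜 W v _ _) → merge-atMostOne (notmin G v W 𝒜) 𝒜 notMinimal-⋃ }

    picks : ∀ {s t} → Run s t → List (Vtx G)
    picks ε                      = []
    picks (pick _ _ w _ _ ◅ run) = w ∷ picks run

    picks⊆ : ∀ {𝒜 W t v} (run : Run (𝒜 , W) t) → v ∈L picks run → v ∈ W
    picks⊆ (pick _ _ w w∈W _ ◅ run) (here refl) = w∈W
    picks⊆ (pick _ W w _ _ ◅ run)   (there v∈)  = p─q⊆p W ⁅ w ⁆ (picks⊆ run v∈)

    picks-unique : ∀ {s t} (run : Run s t) → Unique (picks run)
    picks-unique ε                      = []
    picks-unique (pick _ W w _ _ ◅ run) =
      All.tabulate (λ v∈ w≡v → x∉p-x w W (subst (_∈ W - w) (≡.sym w≡v) (picks⊆ run v∈)))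
      ∷ picks-unique run

    toSet-picks : ∀ {𝒜 W ℬ} (run : Run (𝒜 , W) (ℬ , ∅)) → W ≡ toSet G (picks run)
    toSet-picks ε                        = refl
    toSet-picks (pick _ W w w∈W _ ◅ run) =
      ≡.trans (x∈p⇒p≡⁅x⁆∪p-x w∈W) (≡.cong (⁅ w ⁆ ∪_) (toSet-picks run))

    ∈-picks⇔ : ∀ {𝒜 W ℬ v} (run : Run (𝒜 , W) (ℬ , ∅)) → v ∈ W ⇔ v ∈L picks run
    ∈-picks⇔ {v = v} run =
      subst (λ W → v ∈ W ⇔ v ∈L picks run) (≡.sym (toSet-picks run)) (∈-toSet⇔ (picks run))

    picks-removable : ∀ {𝒜 W ℬ} (run : Run (𝒜 , W) (ℬ , ∅)) → IsPartitionOf G ℬ (∁ X) →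
      RemovableSeq G ℬ (picks run)
    picks-removable ε _ = tt
    picks-removable {ℬ = ℬ} run@(pick 𝒜 W w _ _ ◅ rest) partition =
      subst (λ Y → Removable G w Y ℬ) (toSet-picks run)
        (atMostOne-removable partition
          (run-atMostOne rest (merge-covering-atMostOne (notmin G w W 𝒜) 𝒜 (notMinimal⊆notmin 𝒜))))
      , picks-removable rest partition

lemma3 : (G : Graph) (X : VSet G) (ℬ : List (VSet G)) →
    Algorithm1Returns G X ℬ → GoodPartition G X ℬ
lemma3 G X ℬ (_ , maxClique , _ , isCC , P-XInterval , run) =
  maxClique , ℬ-partition , (λ P′ isCC′ → ⊑-trans G (CC-⊑ G isCC′ isCC) (run-refines G run)) ,
  run-XInterval G run P-XInterval ,
  picks G run , picks-unique G run , (λ v → ∈-picks⇔ G run) , picks-removable G run ℬ-partition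
  where
  ℬ-partition : IsPartitionOf G ℬ (∁ X)
  ℬ-partition = run-isPartition G run (proj₁ isCC)
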